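{- For every set of formulas $\Gamma$ and formula $\phi$: if $\{\gamma=\top\mid\gamma\in\Gamma\}\models_{\mathcal{BHA}}\phi=\top$ then $\Gamma\vdash_s\phi$.
   Context: Fix a countably infinite set $\mathrm{Prop}$ of propositional variables. Bi-intuitionistic formulas are generated by $\phi ::= p \mid \bot \mid \top \mid \phi\wedge\phi \mid \phi\vee\phi \mid \phi\to\phi \mid \phi\prec\phi$ with $p\in\mathrm{Prop}$ ($\prec$ is exclusion). Abbreviations: $\neg\phi := \phi\to\bot$, ${\sim}\phi := \top\prec\phi$. An axiom is any instance of: (A1) $\phi\to(\psi\to\phi)$; (A2) $(\phi\to(\psi\to\chi))\to((\phi\to\psi)\to(\phi\to\chi))$; (A3) $\phi\to(\phi\vee\psi)$; (A4) $\psi\to(\phi\vee\psi)$; (A5) $(\phi\to\chi)\to((\psi\to\chi)\to((\phi\vee\psi)\to\chi))$; (A6) $(\phi\wedge\psi)\to\phi$; (A7) $(\phi\wedge\psi)\to\psi$; (A8) $(\chi\to\phi)\to((\chi\to\psi)\to(\chi\to(\phi\wedge\psi)))$; (A9) $\bot\to\phi$; (A10) $\phi\to\top$; (A11) $\phi\to(\psi\vee(\phi\prec\psi))$; (A12) $(\phi\prec\psi)\to{\sim}(\phi\to\psi)$; (A13) $((\phi\prec\psi)\prec\chi)\to(\phi\prec(\psi\vee\chi))$; (A14) $\neg(\phi\prec\psi)\to(\phi\to\psi)$. sBIL is the relation $\Gamma\vdash_s\phi$ holding iff $\Gamma\vdash\phi$ is derivable with: (Ax) $\Gamma\vdash\phi$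 for any axiom $\phi$; (El) $\Gamma\vdash\phi$ if $\phi\in\Gamma$; (MP) from $\Gamma\vdash\phi$ and $\Gamma\vdash\phi\to\psi$ infer $\Gamma\vdash\psi$; (sDN) from $\Gamma\vdash\phi$ infer $\Gamma\vdash\neg{\sim}\phi$. A bi-Heyting algebra is an algebra $(A,\top,\bot,\wedge,\vee,\to,\prec)$ whose reduct $(A,\top,\bot,\wedge,\vee)$ is a bounded lattice (order $a\le b$ iff $a=a\wedge b$) with $a\wedge b\le c\iff a\le b\to c$ and $a\le b\vee c\iff a\prec b\le c$ for all $a,b,c$; $\mathcal{BHA}$ is the class of all bi-Heyting algebras. A valuation $v:\mathrm{Prop}\to A$ extends to $\bar v$ on formulas. For a set of equations $\Theta$, $\Theta\models_{\mathcal{BHA}}\phi=\psi$ means: for all $A\in\mathcal{BHA}$ and valuations $v$ on $A$, if $\bar v(\theta)=\bar v(\eta)$ for all $(\theta=\eta)\in\Theta$ then $\bar v(\phi)=\bar v(\psi)$. -}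

module Defs where

open import Level using (Level; suc; _⊔_; 0ℓ)
open import Data.Nat using (ℕ)
open import Data.Product using (_×_)
open import Algebra.Core using (Op₂)
open import Algebra.Definitions using (Congruent₂)
open import Algebra.Lattice.Structures using (IsLattice)

Prop : Set
Prop = ℕ

infixr 6 _∧'_
infixr 5 _∨'_
infixr 4 _⇒_ _≺_

data Formula : Set where
  var  : Prop → Formula
  ⊥'   : Formula
  ⊤'   : Formula
  _∧'_ : Formula → Formula → Formula
  _∨'_ : Formula → Formula → Formula
  _⇒_  : Formula → Formula → Formula
  _≺_  : Formula → Formula → Formula

¬' : Formula → Formula
¬' φ = φ ⇒ ⊥'

∼' : Formula → Formula
∼' φ = ⊤' ≺ φ

data Axiom : Formula → Set where
  A1  : ∀ φ ψ → Axiom (φ ⇒ (ψ ⇒ φ))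
  A2  : ∀ φ ψ χ → Axiom ((φ ⇒ (ψ ⇒ χ)) ⇒ ((φ ⇒ ψ) ⇒ (φ ⇒ χ)))
  A3  : ∀ φ ψ → Axiom (φ ⇒ (φ ∨' ψ))
  A4  : ∀ φ ψ → Axiom (ψ ⇒ (φ ∨' ψ))
  A5  : ∀ φ ψ χ → Axiom ((φ ⇒ χ) ⇒ ((ψ ⇒ χ) ⇒ ((φ ∨' ψ) ⇒ χ)))
  A6  : ∀ φ ψ → Axiom ((φ ∧' ψ) ⇒ φ)
  A7  : ∀ φ ψ → Axiom ((φ ∧' ψ) ⇒ ψ)
  A8  : ∀ φ ψ χ → Axiom ((χ ⇒ φ) ⇒ ((χ ⇒ ψ) ⇒ (χ ⇒ (φ ∧' ψ))))
  A9  : ∀ φ → Axiom (⊥' ⇒ φ)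
  A10 : ∀ φ → Axiom (φ ⇒ ⊤')
  A11 : ∀ φ ψ → Axiom (φ ⇒ (ψ ∨' (φ ≺ ψ)))
  A12 : ∀ φ ψ → Axiom ((φ ≺ ψ) ⇒ ∼' (φ ⇒ ψ))
  A13 : ∀ φ ψ χ → Axiom (((φ ≺ ψ) ≺ χ) ⇒ (φ ≺ (ψ ∨' χ)))
  A14 : ∀ φ ψ → Axiom (¬' (φ ≺ ψ) ⇒ (φ ⇒ ψ))

FSet : Set₁
FSet = Formula → Set

infix 2 _⊢s_
data _⊢s_ (Γ : FSet) : Formula → Set where
  ax  : ∀ {φ} → Axiom φ → Γ ⊢s φ
  el  : ∀ {φ} → Γ φ → Γ ⊢s φ
  mp  : ∀ {φ ψ} → Γ ⊢s φ → Γ ⊢s (φ ⇒ ψ) → Γ ⊢s ψ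
  sdn : ∀ {φ} → Γ ⊢s φ → Γ ⊢s ¬' (∼' φ)

record BiHeytingAlgebra (c ℓ : Level) : Set (suc (c ⊔ ℓ)) where
  infix 4 _≈_ _≤_
  field
    Carrier : Set c
    _≈_     : Carrier → Carrier → Set ℓ
    ⊤ ⊥     : Carrier
    _∧_ _∨_ _→ᴬ_ _≺ᴬ_ : Op₂ Carrier
    isLattice : IsLattice _≈_ _∨_ _∧_
    ⊤-max     : ∀ a → a ≈ a ∧ ⊤
    ⊥-min     : ∀ a → ⊥ ≈ ⊥ ∧ a
    →-cong    : Congruent₂ _≈_ _→ᴬ_
    ≺-cong    : Congruent₂ _≈_ _≺ᴬ_

  _≤_ : Carrier → Carrier → Set ℓ
  a ≤ b = a ≈ a ∧ b

  field
    →-residual₁ : ∀ a b c → a ∧ b ≤ c → a ≤ b →ᴬ c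
    →-residual₂ : ∀ a b c → a ≤ b →ᴬ c → a ∧ b ≤ c
    ≺-residual₁ : ∀ a b c → a ≤ b ∨ c → a ≺ᴬ b ≤ c
    ≺-residual₂ : ∀ a b c → a ≺ᴬ b ≤ c → a ≤ b ∨ c

module _ {c ℓ} (A : BiHeytingAlgebra c ℓ) where
  open BiHeytingAlgebra A

  ⟦_⟧ : Formula → (Prop → Carrier) → Carrier
  ⟦ var p ⟧  v = v p
  ⟦ ⊥' ⟧     v = ⊥
  ⟦ ⊤' ⟧     v = ⊤
  ⟦ φ ∧' ψ ⟧ v = ⟦ φ ⟧ v ∧ ⟦ ψ ⟧ v
  ⟦ φ ∨' ψ ⟧ v = ⟦ φ ⟧ v ∨ ⟦ ψ ⟧ v
  ⟦ φ ⇒ ψ ⟧  v = ⟦ φ ⟧ v →ᴬ ⟦ ψ ⟧ v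
  ⟦ φ ≺ ψ ⟧  v = ⟦ φ ⟧ v ≺ᴬ ⟦ ψ ⟧ v

EqSet : Set₁
EqSet = Formula → Formula → Set

_⊨BHA[_,_]_≐_ : EqSet → (c ℓ : Level) → Formula → Formula → Set (suc (c ⊔ ℓ))
Θ ⊨BHA[ c , ℓ ] φ ≐ ψ =
  (A : BiHeytingAlgebra c ℓ) (v : Prop → BiHeytingAlgebra.Carrier A) →
  (∀ θ η → Θ θ η → BiHeytingAlgebra._≈_ A (⟦_⟧ A θ v) (⟦_⟧ A η v)) →
  BiHeytingAlgebra._≈_ A (⟦_⟧ A φ v) (⟦_⟧ A ψ v)

topEqs : FSet → EqSet
topEqs Γ θ η = Γ θ × (η ≡ ⊤')
  where open import Relation.Binary.PropositionalEquality using (_≡_)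

module Submission where

-- Completeness via the Lindenbaum–Tarski algebra: formulas modulo provable
-- equivalence over Γ form a bi-Heyting algebra whose identity valuation sends
-- each formula to its own class and each γ ∈ Γ to the class of ⊤; so a formula
-- valid under { γ = ⊤ | γ ∈ Γ } is provably equivalent to ⊤, hence provable.
-- The deduction theorem fails for ⊢s (because of sDN), so the Heyting
-- structure is derived in an auxiliary calculus with local hypotheses over the
-- Γ-theorems. The co-Heyting residuation is where sDN is indispensable.

open import Defs
open import Level using (0ℓ)
open import Data.List using (List; []; _∷_; [_])
open import Data.List.Membership.Propositional using (_∈_)
open import Data.List.Relation.Unary.Any using (here; there)
open import Data.Product using (_×_; _,_)
open import Relation.Binary.PropositionalEquality using (_≡_; refl; cong₂; subst; sym)
open import Relation.Binary.Structures using (IsEquivalence)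
open import Algebra.Lattice.Structures using (IsLattice)

module Lindenbaum (Γ : FSet) where

  infix 2 _⊩_

  data _⊩_ (Δ : List Formula) : Formula → Set where
    thm : ∀ {φ} → Γ ⊢s φ → Δ ⊩ φ
    hyp : ∀ {φ} → φ ∈ Δ → Δ ⊩ φ
    app : ∀ {φ ψ} → Δ ⊩ φ → Δ ⊩ φ ⇒ ψ → Δ ⊩ ψ

  axiom : ∀ {Δ φ} → Axiom φ → Δ ⊩ φ
  axiom a = thm (ax a)

  hyp₀ : ∀ {Δ φ} → φ ∷ Δ ⊩ φ
  hyp₀ = hyp (here refl)

  hyp₁ : ∀ {Δ φ ψ} → ψ ∷ φ ∷ Δ ⊩ φ
  hyp₁ = hyp (there (here refl))

  ⇒-refl : ∀ {Δ} φ → Δ ⊩ φ ⇒ φ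
  ⇒-refl φ = app (axiom (A1 φ φ)) (app (axiom (A1 φ (φ ⇒ φ))) (axiom (A2 φ (φ ⇒ φ) φ)))

  deduction : ∀ {Δ φ ψ} → φ ∷ Δ ⊩ ψ → Δ ⊩ φ ⇒ ψ
  deduction {φ = φ} {ψ} (thm t)                = app (thm t) (axiom (A1 ψ φ))
  deduction {φ = φ}     (hyp (here refl))      = ⇒-refl φ
  deduction {φ = φ} {ψ} (hyp (there ψ∈Δ))      = app (hyp ψ∈Δ) (axiom (A1 ψ φ))
  deduction {φ = φ} {ψ} (app {χ} ⊩χ ⊩χ⇒ψ)      =
    app (deduction ⊩χ) (app (deduction ⊩χ⇒ψ) (axiom (A2 φ χ ψ)))

  weaken : ∀ {Δ φ ψ} → Δ ⊩ φ → ψ ∷ Δ ⊩ φ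
  weaken (thm t)       = thm t
  weaken (hyp φ∈Δ)     = hyp (there φ∈Δ)
  weaken (app ⊩φ ⊩φ⇒ψ) = app (weaken ⊩φ) (weaken ⊩φ⇒ψ)

  closed : ∀ {φ} → [] ⊩ φ → Γ ⊢s φ
  closed (thm t)       = t
  closed (app ⊩φ ⊩φ⇒ψ) = mp (closed ⊩φ) (closed ⊩φ⇒ψ)

  ⊤-intro : ∀ {Δ} → Δ ⊩ ⊤'
  ⊤-intro = app (axiom (A9 ⊤')) (axiom (A10 (⊥' ⇒ ⊤')))

  ⊥-elim : ∀ {Δ φ} → Δ ⊩ ⊥' → Δ ⊩ φ
  ⊥-elim {φ = φ} ⊩⊥ = app ⊩⊥ (axiom (A9 φ))

  ∧-intro : ∀ {Δ φ ψ} → Δ ⊩ φ → Δ ⊩ ψ → Δ ⊩ φ ∧' ψ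
  ∧-intro {φ = φ} {ψ} ⊩φ ⊩ψ =
    app ⊤-intro (app (deduction (weaken ⊩ψ)) (app (deduction (weaken ⊩φ)) (axiom (A8 φ ψ ⊤'))))

  ∧-elim₁ : ∀ {Δ φ ψ} → Δ ⊩ φ ∧' ψ → Δ ⊩ φ
  ∧-elim₁ {φ = φ} {ψ} ⊩φ∧ψ = app ⊩φ∧ψ (axiom (A6 φ ψ))

  ∧-elim₂ : ∀ {Δ φ ψ} → Δ ⊩ φ ∧' ψ → Δ ⊩ ψ
  ∧-elim₂ {φ = φ} {ψ} ⊩φ∧ψ = app ⊩φ∧ψ (axiom (A7 φ ψ))

  ∨-intro₁ : ∀ {Δ φ ψ} → Δ ⊩ φ → Δ ⊩ φ ∨' ψ
  ∨-intro₁ {φ = φ} {ψ} ⊩φ = app ⊩φ (axiom (A3 φ ψ))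

  ∨-intro₂ : ∀ {Δ φ ψ} → Δ ⊩ ψ → Δ ⊩ φ ∨' ψ
  ∨-intro₂ {φ = φ} {ψ} ⊩ψ = app ⊩ψ (axiom (A4 φ ψ))

  ∨-elim : ∀ {Δ φ ψ χ} → Δ ⊩ φ ∨' ψ → φ ∷ Δ ⊩ χ → ψ ∷ Δ ⊩ χ → Δ ⊩ χ
  ∨-elim {φ = φ} {ψ} {χ} ⊩φ∨ψ φ⊩χ ψ⊩χ =
    app ⊩φ∨ψ (app (deduction ψ⊩χ) (app (deduction φ⊩χ) (axiom (A5 φ ψ χ))))

  infix 3 _⊑_ _≃_

  _⊑_ : Formula → Formula → Set
  φ ⊑ ψ = Γ ⊢s φ ⇒ ψ

  _≃_ : Formula → Formula → Set
  φ ≃ ψ = φ ⊑ ψ × ψ ⊑ φ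

  ⊑-intro : ∀ {φ ψ} → [ φ ] ⊩ ψ → φ ⊑ ψ
  ⊑-intro φ⊩ψ = closed (deduction φ⊩ψ)

  ⊑-elim : ∀ {Δ φ ψ} → φ ⊑ ψ → Δ ⊩ φ → Δ ⊩ ψ
  ⊑-elim φ⊑ψ ⊩φ = app ⊩φ (thm φ⊑ψ)

  ⊑-trans : ∀ {φ ψ χ} → φ ⊑ ψ → ψ ⊑ χ → φ ⊑ χ
  ⊑-trans φ⊑ψ ψ⊑χ = ⊑-intro (⊑-elim ψ⊑χ (⊑-elim φ⊑ψ hyp₀))

  -- sDN turns φ ⊑ ψ ∨ χ into ¬∼(φ ⇒ ψ ∨ χ); then A12 refutes φ ≺ (ψ ∨ χ),
  -- A13 refutes (φ ≺ ψ) ≺ χ, and A14 concludes.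
  ≺-residual-⇐ : ∀ φ ψ χ → φ ⊑ ψ ∨' χ → φ ≺ ψ ⊑ χ
  ≺-residual-⇐ φ ψ χ φ⊑ψ∨χ = mp ¬[[φ≺ψ]≺χ] (ax (A14 (φ ≺ ψ) χ))
    where
      ¬[φ≺ψ∨χ] : Γ ⊢s ¬' (φ ≺ (ψ ∨' χ))
      ¬[φ≺ψ∨χ] = ⊑-intro (app (⊑-elim (ax (A12 φ (ψ ∨' χ))) hyp₀) (thm (sdn φ⊑ψ∨χ)))

      ¬[[φ≺ψ]≺χ] : Γ ⊢s ¬' ((φ ≺ ψ) ≺ χ)
      ¬[[φ≺ψ]≺χ] = ⊑-intro (app (⊑-elim (ax (A13 φ ψ χ)) hyp₀) (thm ¬[φ≺ψ∨χ]))

  ≺-residual-⇒ : ∀ φ ψ χ → φ ≺ ψ ⊑ χ → φ ⊑ ψ ∨' χ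
  ≺-residual-⇒ φ ψ χ φ≺ψ⊑χ =
    ⊑-intro (∨-elim (⊑-elim (ax (A11 φ ψ)) hyp₀) (∨-intro₁ hyp₀) (∨-intro₂ (⊑-elim φ≺ψ⊑χ hyp₀)))

  ≺-monoˡ : ∀ {φ φ′ ψ} → φ ⊑ φ′ → φ ≺ ψ ⊑ φ′ ≺ ψ
  ≺-monoˡ {φ} {φ′} {ψ} φ⊑φ′ =
    ≺-residual-⇐ φ ψ (φ′ ≺ ψ) (⊑-intro (⊑-elim (ax (A11 φ′ ψ)) (⊑-elim φ⊑φ′ hyp₀)))

  ≺-antitoneʳ : ∀ {φ ψ ψ′} → ψ′ ⊑ ψ → φ ≺ ψ ⊑ φ ≺ ψ′
  ≺-antitoneʳ {φ} {ψ} {ψ′} ψ′⊑ψ = ≺-residual-⇐ φ ψ (φ ≺ ψ′)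
    (⊑-intro (∨-elim (⊑-elim (ax (A11 φ ψ′)) hyp₀) (∨-intro₁ (⊑-elim ψ′⊑ψ hyp₀)) (∨-intro₂ hyp₀)))

  ⊑⇒≃∧ : ∀ {φ ψ} → φ ⊑ ψ → φ ≃ φ ∧' ψ
  ⊑⇒≃∧ φ⊑ψ = ⊑-intro (∧-intro hyp₀ (⊑-elim φ⊑ψ hyp₀)) , ⊑-intro (∧-elim₁ hyp₀)

  ≃∧⇒⊑ : ∀ {φ ψ} → φ ≃ φ ∧' ψ → φ ⊑ ψ
  ≃∧⇒⊑ (φ⊑φ∧ψ , _) = ⊑-intro (∧-elim₂ (⊑-elim φ⊑φ∧ψ hyp₀))

  ≃-isEquivalence : IsEquivalence _≃_
  ≃-isEquivalence = record
    { refl  = ⊑-intro hyp₀ , ⊑-intro hyp₀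
    ; sym   = λ (φ⊑ψ , ψ⊑φ) → ψ⊑φ , φ⊑ψ
    ; trans = λ (φ⊑ψ , ψ⊑φ) (ψ⊑χ , χ⊑ψ) → ⊑-trans φ⊑ψ ψ⊑χ , ⊑-trans χ⊑ψ ψ⊑φ
    }

  ≃-isLattice : IsLattice _≃_ _∨'_ _∧'_
  ≃-isLattice = record
    { isEquivalence = ≃-isEquivalence
    ; ∨-comm  = λ _ _ → ∨-swap , ∨-swap
    ; ∨-assoc = λ _ _ _ →
        ⊑-intro (∨-elim hyp₀ (∨-elim hyp₀ (∨-intro₁ hyp₀) (∨-intro₂ (∨-intro₁ hyp₀))) (∨-intro₂ (∨-intro₂ hyp₀)))
      , ⊑-intro (∨-elim hyp₀ (∨-intro₁ (∨-intro₁ hyp₀)) (∨-elim hyp₀ (∨-intro₁ (∨-intro₂ hyp₀)) (∨-intro₂ hyp₀)))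
    ; ∨-cong  = λ (φ⊑φ′ , φ′⊑φ) (ψ⊑ψ′ , ψ′⊑ψ) → ∨-mono φ⊑φ′ ψ⊑ψ′ , ∨-mono φ′⊑φ ψ′⊑ψ
    ; ∧-comm  = λ _ _ → ∧-swap , ∧-swap
    ; ∧-assoc = λ _ _ _ →
        ⊑-intro (∧-intro (∧-elim₁ (∧-elim₁ hyp₀)) (∧-intro (∧-elim₂ (∧-elim₁ hyp₀)) (∧-elim₂ hyp₀)))
      , ⊑-intro (∧-intro (∧-intro (∧-elim₁ hyp₀) (∧-elim₁ (∧-elim₂ hyp₀))) (∧-elim₂ (∧-elim₂ hyp₀)))
    ; ∧-cong  = λ (φ⊑φ′ , φ′⊑φ) (ψ⊑ψ′ , ψ′⊑ψ) → ∧-mono φ⊑φ′ ψ⊑ψ′ , ∧-mono φ′⊑φ ψ′⊑ψ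
    ; absorptive =
        (λ _ _ → ⊑-intro (∨-elim hyp₀ hyp₀ (∧-elim₁ hyp₀)) , ⊑-intro (∨-intro₁ hyp₀))
      , (λ _ _ → ⊑-intro (∧-elim₁ hyp₀) , ⊑-intro (∧-intro hyp₀ (∨-intro₁ hyp₀)))
    }
    where
      ∨-swap : ∀ {φ ψ} → φ ∨' ψ ⊑ ψ ∨' φ
      ∨-swap = ⊑-intro (∨-elim hyp₀ (∨-intro₂ hyp₀) (∨-intro₁ hyp₀))

      ∧-swap : ∀ {φ ψ} → φ ∧' ψ ⊑ ψ ∧' φ
      ∧-swap = ⊑-intro (∧-intro (∧-elim₂ hyp₀) (∧-elim₁ hyp₀))

      ∨-mono : ∀ {φ φ′ ψ ψ′} → φ ⊑ φ′ → ψ ⊑ ψ′ → φ ∨' ψ ⊑ φ′ ∨' ψ′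
      ∨-mono φ⊑φ′ ψ⊑ψ′ =
        ⊑-intro (∨-elim hyp₀ (∨-intro₁ (⊑-elim φ⊑φ′ hyp₀)) (∨-intro₂ (⊑-elim ψ⊑ψ′ hyp₀)))

      ∧-mono : ∀ {φ φ′ ψ ψ′} → φ ⊑ φ′ → ψ ⊑ ψ′ → φ ∧' ψ ⊑ φ′ ∧' ψ′
      ∧-mono φ⊑φ′ ψ⊑ψ′ =
        ⊑-intro (∧-intro (⊑-elim φ⊑φ′ (∧-elim₁ hyp₀)) (⊑-elim ψ⊑ψ′ (∧-elim₂ hyp₀)))

  ⇒-mono : ∀ {φ φ′ ψ ψ′} → φ′ ⊑ φ → ψ ⊑ ψ′ → φ ⇒ ψ ⊑ φ′ ⇒ ψ′
  ⇒-mono φ′⊑φ ψ⊑ψ′ = ⊑-intro (deduction (⊑-elim ψ⊑ψ′ (app (⊑-elim φ′⊑φ hyp₀) hyp₁)))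

  ≺-mono : ∀ {φ φ′ ψ ψ′} → φ ⊑ φ′ → ψ′ ⊑ ψ → φ ≺ ψ ⊑ φ′ ≺ ψ′
  ≺-mono φ⊑φ′ ψ′⊑ψ = ⊑-trans (≺-monoˡ φ⊑φ′) (≺-antitoneʳ ψ′⊑ψ)

  lindenbaum : BiHeytingAlgebra 0ℓ 0ℓ
  lindenbaum = record
    { Carrier     = Formula
    ; _≈_         = _≃_
    ; ⊤           = ⊤'
    ; ⊥           = ⊥'
    ; _∧_         = _∧'_
    ; _∨_         = _∨'_
    ; _→ᴬ_        = _⇒_
    ; _≺ᴬ_        = _≺_
    ; isLattice   = ≃-isLattice
    ; ⊤-max       = λ _ → ⊑⇒≃∧ (⊑-intro ⊤-intro)
    ; ⊥-min       = λ _ → ⊑⇒≃∧ (⊑-intro (⊥-elim hyp₀))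
    ; →-cong      = λ (φ⊑φ′ , φ′⊑φ) (ψ⊑ψ′ , ψ′⊑ψ) → ⇒-mono φ′⊑φ ψ⊑ψ′ , ⇒-mono φ⊑φ′ ψ′⊑ψ
    ; ≺-cong      = λ (φ⊑φ′ , φ′⊑φ) (ψ⊑ψ′ , ψ′⊑ψ) → ≺-mono φ⊑φ′ ψ′⊑ψ , ≺-mono φ′⊑φ ψ⊑ψ′
    ; →-residual₁ = λ _ _ _ φ∧ψ≤χ →
        ⊑⇒≃∧ (⊑-intro (deduction (⊑-elim (≃∧⇒⊑ φ∧ψ≤χ) (∧-intro hyp₁ hyp₀))))
    ; →-residual₂ = λ _ _ _ φ≤ψ⇒χ →
        ⊑⇒≃∧ (⊑-intro (app (∧-elim₂ hyp₀) (⊑-elim (≃∧⇒⊑ φ≤ψ⇒χ) (∧-elim₁ hyp₀))))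
    ; ≺-residual₁ = λ φ ψ χ φ≤ψ∨χ → ⊑⇒≃∧ (≺-residual-⇐ φ ψ χ (≃∧⇒⊑ φ≤ψ∨χ))
    ; ≺-residual₂ = λ φ ψ χ φ≺ψ≤χ → ⊑⇒≃∧ (≺-residual-⇒ φ ψ χ (≃∧⇒⊑ φ≺ψ≤χ))
    }

  ⟦⟧-var : ∀ φ → ⟦_⟧ lindenbaum φ var ≡ φ
  ⟦⟧-var (var p)  = refl
  ⟦⟧-var ⊥'       = refl
  ⟦⟧-var ⊤'       = refl
  ⟦⟧-var (φ ∧' ψ) = cong₂ _∧'_ (⟦⟧-var φ) (⟦⟧-var ψ)
  ⟦⟧-var (φ ∨' ψ) = cong₂ _∨'_ (⟦⟧-var φ) (⟦⟧-var ψ)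
  ⟦⟧-var (φ ⇒ ψ)  = cong₂ _⇒_ (⟦⟧-var φ) (⟦⟧-var ψ)
  ⟦⟧-var (φ ≺ ψ)  = cong₂ _≺_ (⟦⟧-var φ) (⟦⟧-var ψ)

  provable⇒≃⊤ : ∀ {φ} → Γ ⊢s φ → φ ≃ ⊤'
  provable⇒≃⊤ {φ} ⊢φ = ax (A10 φ) , mp ⊢φ (ax (A1 φ ⊤'))

  ≃⊤⇒provable : ∀ {φ} → φ ≃ ⊤' → Γ ⊢s φ
  ≃⊤⇒provable (_ , ⊤⊑φ) = mp (closed ⊤-intro) ⊤⊑φ

  var-satisfies-topEqs : ∀ θ η → topEqs Γ θ η → ⟦_⟧ lindenbaum θ var ≃ ⟦_⟧ lindenbaum η var
  var-satisfies-topEqs θ .⊤' (θ∈Γ , refl) =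
    subst (_≃ ⊤') (sym (⟦⟧-var θ)) (provable⇒≃⊤ (el θ∈Γ))

mainTheorem16 : (Γ : FSet) (φ : Formula) →
    topEqs Γ ⊨BHA[ 0ℓ , 0ℓ ] φ ≐ ⊤' → Γ ⊢s φ
mainTheorem16 Γ φ ⊨φ =
  ≃⊤⇒provable (subst (_≃ ⊤') (⟦⟧-var φ) (⊨φ lindenbaum var var-satisfies-topEqs))
  where open Lindenbaum Γ
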